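{- Let $n \ge 2$ and let $\pi$ be an integer array of length $n-1$ such that $\pi = \pi_x$ for some binary word $x$. Let $S$ be the set of all non-negative integers $k$ such that the array of length $n$ obtained by appending $k$ to the end of $\pi$ equals $\pi_y$ for some binary word $y$ of length $n$. Then $|S| = 2$.
   Context: For a binary word $w$ over $\{0,1\}$, $ones(w)$ denotes the number of $1$'s in $w$. Two binary words of equal length are abelian equivalent if they have the same number of $1$'s. An abelian border of a binary word $w$ is a proper prefix of $w$ (a prefix different from $w$, possibly empty) that is abelian equivalent to the proper suffix of $w$ of the same length. For a binary word $x$ of length $n$, the abelian border array $\pi_x$ is the array of length $n$ with $\pi_x[i]$ ($1\le i\le n$) equal to the length of the longest abelian border of the prefix $x[1\cdots i]$. -}

module Defs where

open import Data.Bool using (Bool; true; false)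
open import Data.Nat using (ℕ; zero; suc; _+_; _∸_; _<_)
open import Data.Nat.Properties using (_≟_)
open import Data.List using (List; []; _∷_; take; drop; length; map; upTo; _++_; [_])
open import Data.Product using (Σ; _×_; ∃)
open import Relation.Binary.PropositionalEquality using (_≡_)
open import Relation.Nullary using (yes; no)

-- Binary words over {0,1}: false = 0, true = 1.
Word : Set
Word = List Bool

ones : Word → ℕ
ones [] = 0
ones (true ∷ w) = suc (ones w)
ones (false ∷ w) = ones w

AbelianEquiv : Word → Word → Set
AbelianEquiv u v = length u ≡ length v × ones u ≡ ones v

IsAbelianBorderLength : Word → ℕ → Set
IsAbelianBorderLength w l = l < length w × AbelianEquiv (take l w) (drop (length w ∸ l) w)

-- length of the longest abelian border of w: search l = c, c-1, ..., 0
-- starting from c = |w| - 1 (l = 0 is always an abelian border).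
longestFrom : Word → ℕ → ℕ
longestFrom w zero = zero
longestFrom w (suc l) with ones (take (suc l) w) ≟ ones (drop (length w ∸ suc l) w)
... | yes _ = suc l
... | no  _ = longestFrom w l

longestAbelianBorder : Word → ℕ
longestAbelianBorder w = longestFrom w (length w ∸ 1)

-- abelian border array π_x : π_x[i] = longest abelian border of x[1..i], 1 ≤ i ≤ |x|
abelianBorderArray : Word → List ℕ
abelianBorderArray x = map (λ i → longestAbelianBorder (take (suc i) x)) (upTo (length x))

IsABA : List ℕ → Set
IsABA π = ∃ λ (x : Word) → abelianBorderArray x ≡ π

InExtensionSet : ℕ → List ℕ → ℕ → Set
InExtensionSet n π k = ∃ λ (y : Word) → length y ≡ n × abelianBorderArray y ≡ π ++ [ k ]

{-# OPTIONS --safe #-}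
module Submission where

-- Appending a letter b to a word x extends π_x by the single entry ℓ(xb), the length of the
-- longest abelian border of xb. Complementing every letter preserves abelian borders, and for a
-- word h t b the border of length |t| + 1 exists exactly when h = b; so ℓ(x0) ≠ ℓ(x1) for
-- nonempty x, and, by induction along the word, π_x determines x up to complement. Hence the
-- words realising π followed by k are x b and (complement of x) b, and S = {ℓ(x0), ℓ(x1)}.

open import Defs
open import Data.Bool using (true; false; not)
open import Data.Bool.Properties using (not-involutive; not-¬)
open import Data.Empty using (⊥-elim)
open import Data.List using (List; []; _∷_; take; drop; length; map; upTo; _++_; [_]; _∷ʳ_)
open import Data.List.Properties
  using (map-++; map-cong; map-∘; map-id; map-cong-local; length-++; length-map; length-upTo; length-take; length-drop;
         take-all; take-map; drop-map; upTo-∷ʳ; ∷ʳ-injective)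
open import Data.List.Relation.Unary.All as All using ()
open import Data.List.Relation.Unary.All.Properties using (all-upTo)
open import Data.List.Reverse using (Reverse; reverseView; []; _∶_∶ʳ_)
open import Data.Nat using (ℕ; zero; suc; _+_; _∸_; _≤_; z≤n; s≤s)
open import Data.Nat.Properties
  using (_≟_; ≤-refl; ≤-trans; ≤-reflexive; n≤1+n; m≤n⇒m≤1+n; m∸n≤m; +-comm; +-∸-assoc; +-cancelʳ-≡;
         m+n∸m≡n; m∸[m∸n]≡n; m≤n⇒m⊓n≡m; 1+n≰n)
open import Data.Product using (_×_; _,_; ∃)
open import Data.Sum using (_⊎_; inj₁; inj₂)
open import Function.Bundles using (_⇔_; mk⇔; Equivalence)
open import Relation.Nullary using (¬_; yes; no)
open import Relation.Binary.PropositionalEquality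
  using (_≡_; _≢_; refl; sym; trans; cong; cong₂; subst; ≢-sym; module ≡-Reasoning)

take-++ˡ : ∀ {a} {A : Set a} n (xs ys : List A) → n ≤ length xs → take n (xs ++ ys) ≡ take n xs
take-++ˡ zero    xs       ys _         = refl
take-++ˡ (suc n) (x ∷ xs) ys (s≤s n≤) = cong (x ∷_) (take-++ˡ n xs ys n≤)

length-∷ʳ : ∀ {a} {A : Set a} (xs : List A) x → length (xs ∷ʳ x) ≡ suc (length xs)
length-∷ʳ xs x = trans (length-++ xs) (+-comm (length xs) 1)

∷ʳ-≢-[] : ∀ {a} {A : Set a} (xs : List A) x → xs ∷ʳ x ≢ []
∷ʳ-≢-[] []       _ ()
∷ʳ-≢-[] (_ ∷ _) _ ()

map-not-∷ʳ : ∀ xs a → map not xs ∷ʳ a ≡ map not (xs ∷ʳ not a)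
map-not-∷ʳ xs a = begin
  map not xs ∷ʳ a                 ≡⟨ cong (map not xs ∷ʳ_) (sym (not-involutive a)) ⟩
  map not xs ∷ʳ not (not a)       ≡⟨ sym (map-++ not xs [ not a ]) ⟩
  map not (xs ∷ʳ not a)           ∎
  where open ≡-Reasoning

ones-++ : ∀ u v → ones (u ++ v) ≡ ones u + ones v
ones-++ []          v = refl
ones-++ (true ∷ u)  v = cong suc (ones-++ u v)
ones-++ (false ∷ u) v = ones-++ u v

ones-∷ : ∀ b u → ones (b ∷ u) ≡ ones [ b ] + ones u
ones-∷ true  u = refl
ones-∷ false u = refl

ones-[-]-injective : ∀ a b → ones [ a ] ≡ ones [ b ] → a ≡ b
ones-[-]-injective true  true  _ = refl
ones-[-]-injective false false _ = refl

ones≤length : ∀ u → ones u ≤ length u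
ones≤length []          = z≤n
ones≤length (true ∷ u)  = s≤s (ones≤length u)
ones≤length (false ∷ u) = m≤n⇒m≤1+n (ones≤length u)

ones-map-not : ∀ u → ones (map not u) ≡ length u ∸ ones u
ones-map-not []          = refl
ones-map-not (true ∷ u)  = ones-map-not u
ones-map-not (false ∷ u) = trans (cong suc (ones-map-not u)) (sym (+-∸-assoc 1 (ones≤length u)))

AbelianBorderAt : Word → ℕ → Set
AbelianBorderAt w l = ones (take l w) ≡ ones (drop (length w ∸ l) w)

longestFrom-yes : ∀ w l → AbelianBorderAt w (suc l) → longestFrom w (suc l) ≡ suc l
longestFrom-yes w l border with ones (take (suc l) w) ≟ ones (drop (length w ∸ suc l) w)
... | yes _       = refl
... | no ¬border = ⊥-elim (¬border border)

longestFrom-no : ∀ w l → ¬ AbelianBorderAt w (suc l) → longestFrom w (suc l) ≡ longestFrom w l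
longestFrom-no w l ¬border with ones (take (suc l) w) ≟ ones (drop (length w ∸ suc l) w)
... | yes border = ⊥-elim (¬border border)
... | no _       = refl

longestFrom≤ : ∀ w l → longestFrom w l ≤ l
longestFrom≤ w zero = z≤n
longestFrom≤ w (suc l) with ones (take (suc l) w) ≟ ones (drop (length w ∸ suc l) w)
... | yes _ = ≤-refl
... | no _  = m≤n⇒m≤1+n (longestFrom≤ w l)

AbelianBorderAt-map-not : ∀ w {l} → l ≤ length w → AbelianBorderAt w l → AbelianBorderAt (map not w) l
AbelianBorderAt-map-not w {l} l≤ border = begin
  ones (take l (map not w))                            ≡⟨ cong ones (take-map l w) ⟩
  ones (map not prefix)                                ≡⟨ ones-map-not prefix ⟩
  length prefix ∸ ones prefix                          ≡⟨ cong₂ _∸_ prefix-length border ⟩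
  l ∸ ones suffix                                      ≡⟨ cong (_∸ ones suffix) (sym suffix-length) ⟩
  length suffix ∸ ones suffix                          ≡⟨ sym (ones-map-not suffix) ⟩
  ones (map not suffix)                                ≡⟨ sym (cong ones (drop-map (length w ∸ l) w)) ⟩
  ones (drop (length w ∸ l) (map not w))               ≡⟨ cong (λ m → ones (drop (m ∸ l) (map not w))) (sym (length-map not w)) ⟩
  ones (drop (length (map not w) ∸ l) (map not w))     ∎
  where
  open ≡-Reasoning
  prefix = take l w
  suffix = drop (length w ∸ l) w
  prefix-length : length prefix ≡ l
  prefix-length = trans (length-take l w) (m≤n⇒m⊓n≡m l≤)
  suffix-length : length suffix ≡ l
  suffix-length = trans (length-drop (length w ∸ l) w) (m∸[m∸n]≡n l≤)

map-not-involutive : ∀ w → map not (map not w) ≡ w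
map-not-involutive w = trans (sym (map-∘ w)) (trans (map-cong not-involutive w) (map-id w))

AbelianBorderAt-map-not⁻ : ∀ w {l} → l ≤ length w → AbelianBorderAt (map not w) l → AbelianBorderAt w l
AbelianBorderAt-map-not⁻ w {l} l≤ border = subst (λ v → AbelianBorderAt v l) (map-not-involutive w)
  (AbelianBorderAt-map-not (map not w) (subst (_ ≤_) (sym (length-map not w)) l≤) border)

longestFrom-map-not : ∀ w l → l ≤ length w → longestFrom (map not w) l ≡ longestFrom w l
longestFrom-map-not w zero    _  = refl
longestFrom-map-not w (suc l) l≤ with ones (take (suc l) (map not w)) ≟ ones (drop (length (map not w) ∸ suc l) (map not w))
                                    | ones (take (suc l) w) ≟ ones (drop (length w ∸ suc l) w)
... | yes _       | yes _       = refl
... | yes border  | no ¬border = ⊥-elim (¬border (AbelianBorderAt-map-not⁻ w l≤ border))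
... | no ¬border | yes border  = ⊥-elim (¬border (AbelianBorderAt-map-not w l≤ border))
... | no _        | no _        = longestFrom-map-not w l (≤-trans (n≤1+n l) l≤)

longestAbelianBorder-map-not : ∀ w → longestAbelianBorder (map not w) ≡ longestAbelianBorder w
longestAbelianBorder-map-not w =
  trans (cong (λ m → longestFrom (map not w) (m ∸ 1)) (length-map not w))
        (longestFrom-map-not w (length w ∸ 1) (m∸n≤m (length w) 1))

longestAbelianBorder-map-not-∷ʳ : ∀ w a → longestAbelianBorder (map not w ∷ʳ a) ≡ longestAbelianBorder (w ∷ʳ not a)
longestAbelianBorder-map-not-∷ʳ w a =
  trans (cong longestAbelianBorder (map-not-∷ʳ w a)) (longestAbelianBorder-map-not (w ∷ʳ not a))

AbelianBorderAt-ends : ∀ h t b → AbelianBorderAt (h ∷ t ∷ʳ b) (suc (length t)) ⇔ (h ≡ b)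
AbelianBorderAt-ends h t b = mk⇔
  (λ border → ones-[-]-injective h b
    (+-cancelʳ-≡ (ones t) _ _ (trans (sym prefix-ones) (trans border suffix-ones))))
  (λ h≡b → trans prefix-ones (trans (cong (λ c → ones [ c ] + ones t) h≡b) (sym suffix-ones)))
  where
  open ≡-Reasoning
  w = h ∷ t ∷ʳ b
  prefix-ones : ones (take (suc (length t)) w) ≡ ones [ h ] + ones t
  prefix-ones = begin
    ones (h ∷ take (length t) (t ∷ʳ b))  ≡⟨ cong (λ u → ones (h ∷ u)) (take-++ˡ (length t) t [ b ] ≤-refl) ⟩
    ones (h ∷ take (length t) t)         ≡⟨ cong (λ u → ones (h ∷ u)) (take-all (length t) t ≤-refl) ⟩
    ones (h ∷ t)                         ≡⟨ ones-∷ h t ⟩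
    ones [ h ] + ones t                  ∎
  suffix-ones : ones (drop (length w ∸ suc (length t)) w) ≡ ones [ b ] + ones t
  suffix-ones = begin
    ones (drop (length (t ∷ʳ b) ∸ length t) w)  ≡⟨ cong (λ m → ones (drop (m ∸ length t) w)) (length-++ t) ⟩
    ones (drop (length t + 1 ∸ length t) w)     ≡⟨ cong (λ m → ones (drop m w)) (m+n∸m≡n (length t) 1) ⟩
    ones (t ∷ʳ b)                               ≡⟨ ones-++ t [ b ] ⟩
    ones t + ones [ b ]                         ≡⟨ +-comm (ones t) _ ⟩
    ones [ b ] + ones t                         ∎

longestAbelianBorder-∷-∷ʳ : ∀ h t b → longestAbelianBorder (h ∷ t ∷ʳ b) ≡ longestFrom (h ∷ t ∷ʳ b) (suc (length t))
longestAbelianBorder-∷-∷ʳ h t b = cong (longestFrom (h ∷ t ∷ʳ b)) (length-∷ʳ t b)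

longestAbelianBorder-equal-ends : ∀ h t → longestAbelianBorder (h ∷ t ∷ʳ h) ≡ suc (length t)
longestAbelianBorder-equal-ends h t =
  trans (longestAbelianBorder-∷-∷ʳ h t h)
        (longestFrom-yes (h ∷ t ∷ʳ h) (length t) (Equivalence.from (AbelianBorderAt-ends h t h) refl))

longestAbelianBorder-distinct-ends : ∀ h t b → h ≢ b → longestAbelianBorder (h ∷ t ∷ʳ b) ≤ length t
longestAbelianBorder-distinct-ends h t b h≢b = subst (_≤ length t)
  (sym (trans (longestAbelianBorder-∷-∷ʳ h t b)
              (longestFrom-no (h ∷ t ∷ʳ b) (length t) (λ border → h≢b (Equivalence.to (AbelianBorderAt-ends h t b) border)))))
  (longestFrom≤ (h ∷ t ∷ʳ b) (length t))

longestAbelianBorder-ends-not : ∀ h t → longestAbelianBorder (h ∷ t ∷ʳ h) ≢ longestAbelianBorder (h ∷ t ∷ʳ not h)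
longestAbelianBorder-ends-not h t eq =
  1+n≰n (subst (_≤ length t) (trans (sym eq) (longestAbelianBorder-equal-ends h t))
               (longestAbelianBorder-distinct-ends h t (not h) (not-¬ refl)))

longestAbelianBorder-∷ʳ-not : ∀ x a → x ≢ [] → longestAbelianBorder (x ∷ʳ a) ≢ longestAbelianBorder (x ∷ʳ not a)
longestAbelianBorder-∷ʳ-not []          _     x≢[] = ⊥-elim (x≢[] refl)
longestAbelianBorder-∷ʳ-not (true ∷ t)  true  _    = longestAbelianBorder-ends-not true t
longestAbelianBorder-∷ʳ-not (false ∷ t) false _    = longestAbelianBorder-ends-not false t
longestAbelianBorder-∷ʳ-not (true ∷ t)  false _    = ≢-sym (longestAbelianBorder-ends-not true t)
longestAbelianBorder-∷ʳ-not (false ∷ t) true  _    = ≢-sym (longestAbelianBorder-ends-not false t)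

longestAbelianBorder-∷ʳ-injective : ∀ x a c → x ≢ [] →
  longestAbelianBorder (x ∷ʳ a) ≡ longestAbelianBorder (x ∷ʳ c) → a ≡ c
longestAbelianBorder-∷ʳ-injective x true  true  _    _  = refl
longestAbelianBorder-∷ʳ-injective x false false _    _  = refl
longestAbelianBorder-∷ʳ-injective x true  false x≢[] eq = ⊥-elim (longestAbelianBorder-∷ʳ-not x true x≢[] eq)
longestAbelianBorder-∷ʳ-injective x false true  x≢[] eq = ⊥-elim (longestAbelianBorder-∷ʳ-not x false x≢[] eq)

length-abelianBorderArray : ∀ x → length (abelianBorderArray x) ≡ length x
length-abelianBorderArray x = trans (length-map _ (upTo (length x))) (length-upTo (length x))

abelianBorderArray-∷ʳ : ∀ x b →
  abelianBorderArray (x ∷ʳ b) ≡ abelianBorderArray x ∷ʳ longestAbelianBorder (x ∷ʳ b)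
abelianBorderArray-∷ʳ x b = begin
  abelianBorderArray (x ∷ʳ b)             ≡⟨ cong (λ m → map f (upTo m)) (length-∷ʳ x b) ⟩
  map f (upTo (suc n))                    ≡⟨ cong (map f) (sym (upTo-∷ʳ n)) ⟩
  map f (upTo n ∷ʳ n)                     ≡⟨ map-++ f (upTo n) [ n ] ⟩
  map f (upTo n) ∷ʳ f n                   ≡⟨ cong₂ _∷ʳ_ earlier-entries last-entry ⟩
  abelianBorderArray x ∷ʳ longestAbelianBorder (x ∷ʳ b) ∎
  where
  open ≡-Reasoning
  n = length x
  f : ℕ → ℕ
  f i = longestAbelianBorder (take (suc i) (x ∷ʳ b))
  earlier-entries : map f (upTo n) ≡ abelianBorderArray x
  earlier-entries = map-cong-local
    (All.map (λ {i} i<n → cong longestAbelianBorder (take-++ˡ (suc i) x [ b ] i<n)) (all-upTo n))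
  last-entry : f n ≡ longestAbelianBorder (x ∷ʳ b)
  last-entry = cong longestAbelianBorder (take-all (suc n) (x ∷ʳ b) (≤-reflexive (length-∷ʳ x b)))

infix 4 _≈ᶜ_
_≈ᶜ_ : Word → Word → Set
x ≈ᶜ y = x ≡ y ⊎ x ≡ map not y

[-]-≈ᶜ : ∀ a c → [ a ] ≈ᶜ [ c ]
[-]-≈ᶜ true  true  = inj₁ refl
[-]-≈ᶜ false false = inj₁ refl
[-]-≈ᶜ true  false = inj₂ refl
[-]-≈ᶜ false true  = inj₂ refl

∷ʳ-≈ᶜ : ∀ {x y} a c → x ≈ᶜ y →
  longestAbelianBorder (x ∷ʳ a) ≡ longestAbelianBorder (y ∷ʳ c) → x ∷ʳ a ≈ᶜ y ∷ʳ c
∷ʳ-≈ᶜ {[]}    a c (inj₁ refl) _ = [-]-≈ᶜ a c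
∷ʳ-≈ᶜ {x@(_ ∷ _)} a c (inj₁ refl) eq
  with refl ← longestAbelianBorder-∷ʳ-injective x a c (λ ()) eq = inj₁ refl
∷ʳ-≈ᶜ {y = []}    a c (inj₂ refl) _ = [-]-≈ᶜ a c
∷ʳ-≈ᶜ {y = y@(_ ∷ _)} a c (inj₂ refl) eq
  with refl ← longestAbelianBorder-∷ʳ-injective y (not a) c (λ ())
                (trans (sym (longestAbelianBorder-map-not-∷ʳ y a)) eq) = inj₂ (map-not-∷ʳ y a)

≈ᶜ-from-abelianBorderArray : ∀ {x y} → Reverse x → Reverse y → abelianBorderArray x ≡ abelianBorderArray y → x ≈ᶜ y
≈ᶜ-from-abelianBorderArray [] [] _ = inj₁ refl
≈ᶜ-from-abelianBorderArray [] (ys ∶ _ ∶ʳ c) eq =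
  ⊥-elim (∷ʳ-≢-[] (abelianBorderArray ys) _ (trans (sym (abelianBorderArray-∷ʳ ys c)) (sym eq)))
≈ᶜ-from-abelianBorderArray (xs ∶ _ ∶ʳ a) [] eq =
  ⊥-elim (∷ʳ-≢-[] (abelianBorderArray xs) _ (trans (sym (abelianBorderArray-∷ʳ xs a)) eq))
≈ᶜ-from-abelianBorderArray (xs ∶ rxs ∶ʳ a) (ys ∶ rys ∶ʳ c) eq
  with earlier , last ← ∷ʳ-injective _ _ (trans (sym (abelianBorderArray-∷ʳ xs a)) (trans eq (abelianBorderArray-∷ʳ ys c)))
  = ∷ʳ-≈ᶜ a c (≈ᶜ-from-abelianBorderArray rxs rys earlier) last

last-entry-of-extension : ∀ x y k → abelianBorderArray y ≡ abelianBorderArray x ∷ʳ k →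
  ∃ λ c → k ≡ longestAbelianBorder (x ∷ʳ c)
last-entry-of-extension x y k eq with reverseView y
... | [] = ⊥-elim (∷ʳ-≢-[] (abelianBorderArray x) k (sym eq))
... | ys ∶ rys ∶ʳ c
  with earlier , last ← ∷ʳ-injective _ _ (trans (sym (abelianBorderArray-∷ʳ ys c)) eq)
  with ≈ᶜ-from-abelianBorderArray rys (reverseView x) earlier
... | inj₁ refl = c , sym last
... | inj₂ refl = not c , trans (sym last) (longestAbelianBorder-map-not-∷ʳ x c)

mainTheorem4 : (n : ℕ) → 2 ≤ n → (π : List ℕ) → length π ≡ n ∸ 1 → IsABA π →
    ∃ λ (k₁ : ℕ) → ∃ λ (k₂ : ℕ) → k₁ ≢ k₂ ×
    ((k : ℕ) → InExtensionSet n π k ⇔ (k ≡ k₁ ⊎ k ≡ k₂))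
mainTheorem4 (suc (suc _)) (s≤s (s≤s _)) _ () ([] , refl)
mainTheorem4 (suc (suc m)) (s≤s (s≤s _)) _ |π| (x@(_ ∷ _) , refl) =
  longestAbelianBorder (x ∷ʳ false) , longestAbelianBorder (x ∷ʳ true) ,
  longestAbelianBorder-∷ʳ-not x false (λ ()) ,
  λ k → mk⇔ (λ (y , _ , eq) → from-last-entry (last-entry-of-extension x y k eq)) extend
  where
  |x| : length x ≡ suc m
  |x| = trans (sym (length-abelianBorderArray x)) |π|
  from-last-entry : ∀ {k} → ∃ (λ c → k ≡ longestAbelianBorder (x ∷ʳ c)) →
    k ≡ longestAbelianBorder (x ∷ʳ false) ⊎ k ≡ longestAbelianBorder (x ∷ʳ true)
  from-last-entry (false , refl) = inj₁ refl
  from-last-entry (true  , refl) = inj₂ refl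
  extension : ∀ b → InExtensionSet (suc (suc m)) (abelianBorderArray x) (longestAbelianBorder (x ∷ʳ b))
  extension b = x ∷ʳ b , trans (length-∷ʳ x b) (cong suc |x|) , abelianBorderArray-∷ʳ x b
  extend : ∀ {k} → k ≡ longestAbelianBorder (x ∷ʳ false) ⊎ k ≡ longestAbelianBorder (x ∷ʳ true) →
    InExtensionSet (suc (suc m)) (abelianBorderArray x) k
  extend (inj₁ refl) = extension false
  extend (inj₂ refl) = extension true
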